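{- Let $(A,\le,\odot,\rightarrow,0,1)$ be a bounded MLUB-complete residuated poset, $(T,R)$ a time frame with $R$ serial, and $P,F,H,G$ the tense operators induced by $(T,R)$. Then for all $C_1,C_2,D_1,D_2,B_1,B_2\in\mathcal P_+(A^T)$: (DT1) $G(U(C_1))\boxdot G(U(C_2))\le\operatorname{Min}U(G(U(C_1\boxdot C_2)))$ and $G(B_1\Rightarrow B_2)\le G(U(B_1))\Rightarrow G(U(B_2))$; (DT2) $L(P(D_1\boxdot D_2))\le U(L(P(D_1))\boxdot L(P(D_2)))$; (DT3) $H(U(C_1))\boxdot H(U(C_2))\le\operatorname{Min}U(H(U(C_1\boxdot C_2)))$ and $H(B_1\Rightarrow B_2)\le H(U(B_1))\Rightarrow H(U(B_2))$; (DT4) $L(F(D_1\boxdot D_2))\le U(L(F(D_1))\boxdot L(F(D_2)))$.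
   Context: A residuated poset $(A,\le,\odot,\rightarrow,0,1)$ is a bounded poset with binary operations $\odot,\rightarrow:A\times A\to A$ such that for all $x,y,z,v$: $x\odot1=x$; $x\odot y=y\odot x$; $\odot$ associative; $x\le v,y\le z$ imply $x\odot y\le v\odot z$; $x\odot y\le z$ iff $x\le y\rightarrow z$. For subsets $X$ of a poset: $L(X)$, $U(X)$ are the sets of lower/upper bounds, $\operatorname{Max}X,\operatorname{Min}X$ the maximal/minimal elements; for subsets $X,Y$, $X\le Y$ iff $x\le y$ for all $x\in X,y\in Y$. MLUB-complete: for every nonempty $M$, every upper bound of $M$ lies above a minimal upper bound and every lower bound below a maximal lower bound. $\mathcal P_+(X)$ = nonempty subsets. In a residuated poset, for nonempty subsets $B,C$: $B\boxdot C=\operatorname{Max}LU(\{b\odot c\mid b\in B,c\in C\})$ and $B\Rightarrow C=\operatorname{Min}U(\bigcap\{L(b\rightarrow d)\mid b\in B,d\in U(C)\})$. $A^T$ is a residuated poset with componentwise order and operations, and for subsets of $A^T$ all of $L,U,\operatorname{Max},\operatorname{Min},\le,\boxdot,\Rightarrow$ are computed in $A^T$. A time frame is $(T,R)$, $T\ne\emptyset$, $R\subseteq T^2$; serial: each $s$ has $r,t$ with $rRs$, $sRt$. The induced tense operators $P,F,H,G:\mathcal P_+(A^T)\to(\mathcal P_+A)^T$ are $P(B)(s)=\operatorname{Min}U(\{q(t)\mid q\in B,tRs\})$, $F(B)(s)=\operatorname{Min}U(\{q(t)\mid q\in B,sRt\})$, $H(B)(s)=\operatorname{Max}L(\{q(t)\mid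 q\in B,tRs\})$, $G(B)(s)=\operatorname{Max}L(\{q(t)\mid q\in B,sRt\})$ (with $L,U$ in $A$). Every $Z\in(\mathcal P_+A)^T$ is identified with the subset $\{q\in A^T\mid q(t)\in Z(t)\ \forall t\}$ of $A^T$, and it is in this form that it enters $L,U,\boxdot,\Rightarrow,\le$ and the tense operators. -}

module Defs where

open import Level using (0ℓ)
open import Data.Product using (Σ; ∃; _×_; _,_)
open import Relation.Binary.PropositionalEquality using (_≡_)
open import Relation.Binary.Structures using (IsPartialOrder)

Sub : Set → Set₁
Sub X = X → Set

module SubsetOps {X : Set} (_≤_ : X → X → Set) where

  NonEmpty : Sub X → Set
  NonEmpty S = ∃ S

  L : Sub X → Sub X
  L S x = ∀ y → S y → x ≤ y

  U : Sub X → Sub X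
  U S x = ∀ y → S y → y ≤ x

  -- maximal / minimal elements (x ≤ y with y ∈ S forces y ≤ x,
  -- i.e. y = x by antisymmetry)
  Max : Sub X → Sub X
  Max S x = S x × (∀ y → S y → x ≤ y → y ≤ x)

  Min : Sub X → Sub X
  Min S x = S x × (∀ y → S y → y ≤ x → x ≤ y)

  _≤ˢ_ : Sub X → Sub X → Set
  S ≤ˢ S' = ∀ x y → S x → S' y → x ≤ y

  MLUBComplete : Set₁
  MLUBComplete = (M : Sub X) → NonEmpty M →
    ((u : X) → U M u → Σ X λ m → Min (U M) m × m ≤ u) ×
    ((l : X) → L M l → Σ X λ m → Max (L M) m × l ≤ m)

record ResiduatedPoset : Set₁ where
  infixl 7 _⊙_
  infixr 5 _⇾_
  infix 4 _≤_
  field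
    Carrier        : Set
    _≤_            : Carrier → Carrier → Set
    isPartialOrder : IsPartialOrder _≡_ _≤_
    _⊙_            : Carrier → Carrier → Carrier
    _⇾_            : Carrier → Carrier → Carrier
    𝟘              : Carrier
    𝟙              : Carrier
    𝟘-least        : ∀ x → 𝟘 ≤ x
    𝟙-greatest     : ∀ x → x ≤ 𝟙
    ⊙-identityʳ    : ∀ x → x ⊙ 𝟙 ≡ x
    ⊙-comm         : ∀ x y → x ⊙ y ≡ y ⊙ x
    ⊙-assoc        : ∀ x y z → (x ⊙ y) ⊙ z ≡ x ⊙ (y ⊙ z)
    ⊙-mono         : ∀ {x y z v} → x ≤ v → y ≤ z → x ⊙ y ≤ v ⊙ z
    residuate      : ∀ {x y z} → x ⊙ y ≤ z → x ≤ y ⇾ z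
    residuate⁻¹    : ∀ {x y z} → x ≤ y ⇾ z → x ⊙ y ≤ z

module Tense (𝐀 : ResiduatedPoset) (T : Set) (R : T → T → Set) where
  open ResiduatedPoset 𝐀 renaming (Carrier to A)

  module OA = SubsetOps _≤_

  AT : Set
  AT = T → A

  _≤T_ : AT → AT → Set
  p ≤T q = ∀ t → p t ≤ q t

  _⊙T_ : AT → AT → AT
  (p ⊙T q) t = p t ⊙ q t

  _⇾T_ : AT → AT → AT
  (p ⇾T q) t = p t ⇾ q t

  open SubsetOps _≤T_ public

  products : Sub AT → Sub AT → Sub AT
  products B C q = Σ AT λ b → Σ AT λ c → B b × C c × (∀ t → q t ≡ (b ⊙T c) t)

  _⊡_ : Sub AT → Sub AT → Sub AT
  B ⊡ C = Max (L (U (products B C)))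

  _⇒_ : Sub AT → Sub AT → Sub AT
  B ⇒ C = Min (U (λ x → ∀ b d → B b → U C d → x ≤T (b ⇾T d)))

  -- identification of Z ∈ (P₊ A)^T with a subset of A^T
  ι : (T → Sub A) → Sub AT
  ι Z q = ∀ t → Z t (q t)

  -- the tense operators, returned already as subsets of A^T
  pastVals : Sub AT → T → Sub A
  pastVals B s a = Σ AT λ q → Σ T λ t → B q × R t s × a ≡ q t

  futVals : Sub AT → T → Sub A
  futVals B s a = Σ AT λ q → Σ T λ t → B q × R s t × a ≡ q t

  P F H G : Sub AT → Sub AT
  P B = ι (λ s → OA.Min (OA.U (pastVals B s)))
  F B = ι (λ s → OA.Min (OA.U (futVals B s)))
  H B = ι (λ s → OA.Max (OA.L (pastVals B s)))
  G B = ι (λ s → OA.Max (OA.L (futVals B s)))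

Serial : {T : Set} → (T → T → Set) → Set
Serial {T} R = ∀ s → (∃ λ r → R r s) × (∃ λ t → R s t)

-- MLUB-completeness yields minimal upper bounds of arbitrary, even empty,
-- subsets of A (adjoin 0), hence pointwise of A^T; moreover every upper bound
-- w of the values at t of a family K ⊆ A^T is above u t for some upper bound
-- u of K.  With this, each inequality reduces by residuation to instants
-- s R t.  For (DT1), say, a(s) ⊙ b(s) ≤ q(t) for every upper bound q of
-- C₁ ⊡ C₂, because b(s) → q(t) bounds every c(t) with c ∈ C₁.  The past
-- operators P, H are F, G for the converse relation, so (DT2) and (DT3) are
-- (DT4) and (DT1) again.
module Submission where

open import Defs
open import Data.Product using (_×_; Σ; ∃; _,_; proj₁; proj₂)
open import Data.Sum using (_⊎_; inj₁; inj₂)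
open import Function using (flip)
open import Relation.Binary.PropositionalEquality using (_≡_; refl; sym; subst)
open import Relation.Binary.Structures using (IsPartialOrder)

module _ {X : Set} (_≤_ : X → X → Set) where
  open SubsetOps _≤_

  MinimalUpperBoundsOf : Sub X → Set
  MinimalUpperBoundsOf M = ∀ u → U M u → Σ X λ m → Min (U M) m × m ≤ u

  module _ (⊥ : X) (⊥-least : ∀ x → ⊥ ≤ x) where

    private
      _∪⊥ : Sub X → Sub X
      (M ∪⊥) x = M x ⊎ x ≡ ⊥

      U-∪⊥ : ∀ {M y} → U M y → U (M ∪⊥) y
      U-∪⊥ y-upper x (inj₁ x∈M) = y-upper x x∈M
      U-∪⊥ {y = y} _ _ (inj₂ refl) = ⊥-least y

    minimalUpperBounds : (∀ M → NonEmpty M → MinimalUpperBoundsOf M) →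
      ∀ M → MinimalUpperBoundsOf M
    minimalUpperBounds complete M u u-upper
      with complete (M ∪⊥) (⊥ , inj₂ refl) u (U-∪⊥ u-upper)
    ... | m , (m-upper , m-minimal) , m≤u =
      m , ((λ x x∈M → m-upper x (inj₁ x∈M)) ,
           (λ y y-upper → m-minimal y (U-∪⊥ y-upper))) ,
          m≤u

values : {T X : Set} → Sub (T → X) → T → Sub X
values K t x = ∃ λ k → K k × x ≡ k t

module Pointwise {X : Set} (_≤_ : X → X → Set) (T : Set)
                 (minUpper : ∀ M → MinimalUpperBoundsOf _≤_ M) where
  module OX = SubsetOps _≤_

  _≤ᵀ_ : (T → X) → (T → X) → Set
  p ≤ᵀ q = ∀ t → p t ≤ q t

  open SubsetOps _≤ᵀ_

  U-values : ∀ {K u} → U K u → ∀ t → OX.U (values K t) (u t)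
  U-values u-upper t _ (k , k∈K , refl) = u-upper k k∈K t

  minimalUpperBoundsᵀ : ∀ K → MinimalUpperBoundsOf _≤ᵀ_ K
  minimalUpperBoundsᵀ K u u-upper =
    m , ((λ k k∈K t → proj₁ (m-min t) (k t) (k , k∈K , refl)) ,
         (λ y y-upper y≤m t → proj₂ (m-min t) (y t) (U-values y-upper t) (y≤m t))) ,
        (λ t → proj₂ (proj₂ (pick t)))
    where
      pick : ∀ t → Σ X λ m → OX.Min (OX.U (values K t)) m × m ≤ u t
      pick t = minUpper (values K t) (u t) (U-values u-upper t)
      m : T → X
      m t = proj₁ (pick t)
      m-min : ∀ t → OX.Min (OX.U (values K t)) (m t)
      m-min t = proj₁ (proj₂ (pick t))

  U-values-lift : (⊤ : X) → (∀ x → x ≤ ⊤) → (∀ {x} → x ≤ x) →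
    ∀ K t w → OX.U (values K t) w → Σ (T → X) λ u → U K u × u t ≤ w
  U-values-lift ⊤ ≤-⊤ ≤-refl K t w w-upper =
    u , (λ k k∈K t′ → proj₁ (u-min t′) (k t′) (inj₁ (k , k∈K , refl))) ,
        proj₂ (u-min t) w w-upper′ (proj₁ (u-min t) w (inj₂ (refl , refl)))
    where
      -- T has no decidable equality, so w is imposed at t by adjoining it to
      -- the values there; minimality then forces u t ≤ w.
      M : T → Sub X
      M t′ x = values K t′ x ⊎ (t′ ≡ t × x ≡ w)
      pick : ∀ t′ → Σ X λ m → OX.Min (OX.U (M t′)) m × m ≤ ⊤
      pick t′ = minUpper (M t′) ⊤ (λ x _ → ≤-⊤ x)
      u : T → X
      u t′ = proj₁ (pick t′)
      u-min : ∀ t′ → OX.Min (OX.U (M t′)) (u t′)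
      u-min t′ = proj₁ (proj₂ (pick t′))
      w-upper′ : OX.U (M t) w
      w-upper′ x (inj₁ x∈K) = w-upper x x∈K
      w-upper′ _ (inj₂ (_ , refl)) = ≤-refl

module TenseProperties (𝐀 : ResiduatedPoset)
                       (mlub : SubsetOps.MLUBComplete (ResiduatedPoset._≤_ 𝐀))
                       (T : Set) (R : T → T → Set) where
  open ResiduatedPoset 𝐀 renaming (Carrier to A)
  open IsPartialOrder isPartialOrder using () renaming (refl to ≤-refl; trans to ≤-trans)
  open Tense 𝐀 T R

  minUpper : ∀ M → MinimalUpperBoundsOf _≤_ M
  minUpper = minimalUpperBounds _≤_ 𝟘 𝟘-least (λ M ne → proj₁ (mlub M ne))

  -- For the reversed order, U and Min of SubsetOps are L and Max on the nose.
  maxLower : ∀ M → MinimalUpperBoundsOf (flip _≤_) M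
  maxLower = minimalUpperBounds (flip _≤_) 𝟙 𝟙-greatest (λ M ne → proj₂ (mlub M ne))

  module ≤ᵀ = Pointwise _≤_ T minUpper
  module ≥ᵀ = Pointwise (flip _≤_) T maxLower

  minUpperᵀ : ∀ K u → U K u → Σ AT λ m → Min (U K) m × m ≤T u
  minUpperᵀ = ≤ᵀ.minimalUpperBoundsᵀ

  maxLowerᵀ : ∀ K l → L K l → Σ AT λ m → Max (L K) m × l ≤T m
  maxLowerᵀ = ≥ᵀ.minimalUpperBoundsᵀ

  U-values-lift : ∀ K t w → OA.U (values K t) w → Σ AT λ u → U K u × u t ≤ w
  U-values-lift = ≤ᵀ.U-values-lift 𝟙 𝟙-greatest ≤-refl

  L-values-lift : ∀ K t w → OA.L (values K t) w → Σ AT λ l → L K l × w ≤ l t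
  L-values-lift = ≥ᵀ.U-values-lift 𝟘 𝟘-least ≤-refl

  residuateˡ : ∀ {x y z} → x ⊙ y ≤ z → y ≤ x ⇾ z
  residuateˡ {x} {y} {z} xy≤z = residuate (subst (_≤ z) (⊙-comm x y) xy≤z)

  ⇾-swap : ∀ {x y z} → x ≤ y ⇾ z → y ≤ x ⇾ z
  ⇾-swap x≤y⇾z = residuateˡ (residuate⁻¹ x≤y⇾z)

  ≤T-trans : ∀ {p q r} → p ≤T q → q ≤T r → p ≤T r
  ≤T-trans p≤q q≤r t = ≤-trans (p≤q t) (q≤r t)

  G-lower : ∀ {X g s t} → G X g → R s t → ∀ q → X q → g s ≤ q t
  G-lower g∈G sRt q q∈X = proj₁ (g∈G _) (q _) (q , _ , q∈X , sRt , refl)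

  F-upper : ∀ {X f s t} → F X f → R s t → ∀ q → X q → q t ≤ f s
  F-upper f∈F sRt q q∈X = proj₁ (f∈F _) (q _) (q , _ , q∈X , sRt , refl)

  below-U-G : ∀ {X a y} → (∀ {s t} → R s t → ∀ q → X q → a s ≤ q t) → U (G X) y → a ≤T y
  below-U-G {X} {a} a-lower y-upper =
    ≤T-trans (λ s → proj₂ (proj₂ (pick s))) (y-upper g g∈G)
    where
      pick : ∀ s → Σ A λ m → OA.Max (OA.L (futVals X s)) m × a s ≤ m
      pick s = maxLower (futVals X s) (a s)
        λ { _ (q , _ , q∈X , sRt , refl) → a-lower sRt q q∈X }
      g : AT
      g s = proj₁ (pick s)
      g∈G : G X g
      g∈G s = proj₁ (proj₂ (pick s))

  above-L-F : ∀ {X a y} → (∀ {s t} → R s t → ∀ q → X q → q t ≤ a s) → L (F X) y → y ≤T a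
  above-L-F {X} {a} a-upper y-lower =
    ≤T-trans (y-lower f f∈F) (λ s → proj₂ (proj₂ (pick s)))
    where
      pick : ∀ s → Σ A λ m → OA.Min (OA.U (futVals X s)) m × m ≤ a s
      pick s = minUpper (futVals X s) (a s)
        λ { _ (q , _ , q∈X , sRt , refl) → a-upper sRt q q∈X }
      f : AT
      f s = proj₁ (pick s)
      f∈F : F X f
      f∈F s = proj₁ (proj₂ (pick s))

  ⊙∈products : ∀ {B C b c} → B b → C c → products B C (b ⊙T c)
  ⊙∈products {b = b} {c} b∈B c∈C = b , c , b∈B , c∈C , λ _ → refl

  U-products : ∀ {B C u} → (∀ {b c} → B b → C c → (b ⊙T c) ≤T u) → U (products B C) u
  U-products {u = u} bc≤u _ (_ , _ , b∈B , c∈C , p≡) t =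
    subst (_≤ u t) (sym (p≡ t)) (bc≤u b∈B c∈C t)

  LU-products≤U-⊡ : ∀ {B C x y} → L (U (products B C)) x → U (B ⊡ C) y → x ≤T y
  LU-products≤U-⊡ {B} {C} {x} x-lower y-upper
    with maxLowerᵀ (U (products B C)) x x-lower
  ... | m , m∈⊡ , x≤m = ≤T-trans x≤m (y-upper m m∈⊡)

  U-⊡⇒U-products : ∀ {B C q} → U (B ⊡ C) q → U (products B C) q
  U-⊡⇒U-products q-upper p p∈products =
    LU-products≤U-⊡ (λ u u-upper → u-upper p p∈products) q-upper

  ⇾-upper-⊡ : ∀ {B C b q} → U (B ⊡ C) q → B b → U C (b ⇾T q)
  ⇾-upper-⊡ q-upper b∈B c c∈C t =
    residuateˡ (U-⊡⇒U-products q-upper _ (⊙∈products b∈B c∈C) t)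

  residualLowers : Sub AT → Sub AT → Sub AT
  residualLowers B C z = ∀ b d → B b → U C d → z ≤T (b ⇾T d)

  ⇾-upper-residualLowers : ∀ {B C q z} → U C q → residualLowers B C z → U B (z ⇾T q)
  ⇾-upper-residualLowers {q = q} q-upper z-lower b b∈B t =
    ⇾-swap (z-lower b q b∈B q-upper t)

  below-Min-U-at : ∀ {K α t w} →
    (∀ h → Min (U K) h → α ≤ h t) → OA.U (values K t) w → α ≤ w
  below-Min-U-at {K} {t = t} {w} α-lower w-upper with U-values-lift K t w w-upper
  ... | u , u-upper , ut≤w with minUpperᵀ K u u-upper
  ...   | h , h-min , h≤u = ≤-trans (α-lower h h-min) (≤-trans (h≤u t) ut≤w)

  ⊙-below : ∀ {K C α β t q} →
    (∀ h → Min (U K) h → α ≤ h t) → (∀ u → U C u → β ≤ u t) →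
    (∀ k → K k → U C (k ⇾T q)) → α ⊙ β ≤ q t
  ⊙-below {K} {β = β} {t} {q} α-lower β-lower residuals-upper =
    residuate⁻¹ (below-Min-U-at α-lower residual-upper)
    where
      residual-upper : OA.U (values K t) (β ⇾ q t)
      residual-upper _ (k , k∈K , refl) = ⇾-swap (β-lower (k ⇾T q) (residuals-upper k k∈K))

  ⊙-below-U-G : ∀ {K C D a b y} →
    (∀ {s t} → R s t → ∀ h → Min (U K) h → a s ≤ h t) → G (U C) b →
    (∀ q → U D q → ∀ k → K k → U C (k ⇾T q)) → U (G (U D)) y → (a ⊙T b) ≤T y
  ⊙-below-U-G a-lower b∈G residuals-upper = below-U-G λ sRt q q-upper →
    ⊙-below (a-lower sRt) (G-lower b∈G sRt) (residuals-upper q q-upper)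

  G∘U-⊡ : ∀ C₁ C₂ → (G (U C₁) ⊡ G (U C₂)) ≤ˢ Min (U (G (U (C₁ ⊡ C₂))))
  G∘U-⊡ C₁ C₂ x y x∈⊡ y-min = proj₁ x∈⊡ y (U-products λ a∈G b∈G →
    ⊙-below-U-G {K = C₁} (λ sRt h h-min → G-lower a∈G sRt h (proj₁ h-min)) b∈G
                (λ q q-upper _ → ⇾-upper-⊡ q-upper) (proj₁ y-min))

  G-⇒ : ∀ B₁ B₂ → G (B₁ ⇒ B₂) ≤ˢ (G (U B₁) ⇒ G (U B₂))
  G-⇒ B₁ B₂ x y x∈G y-min = proj₁ y-min x λ b d b∈G d-upper t → residuate
    (⊙-below-U-G {K = residualLowers B₁ B₂} (G-lower x∈G) b∈G
                 (λ q q-upper _ → ⇾-upper-residualLowers q-upper) d-upper t)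

  L∘F-⊡ : ∀ D₁ D₂ → L (F (D₁ ⊡ D₂)) ≤ˢ U (L (F D₁) ⊡ L (F D₂))
  L∘F-⊡ D₁ D₂ x y x-lower y-upper =
    LU-products≤U-⊡ (λ u u-upper → above-L-F (⊡-below u-upper) x-lower) y-upper
    where
      below-L-F : ∀ {D d s t} → R s t → D d → Σ AT λ l → L (F D) l × d t ≤ l s
      below-L-F {D} {d} {s} {t} sRt d∈D =
        L-values-lift (F D) s (d t) λ { _ (f , f∈F , refl) → F-upper f∈F sRt d d∈D }

      products-below : ∀ {u s t} → U (products (L (F D₁)) (L (F D₂))) u → R s t →
        OA.U (values (products D₁ D₂) t) (u s)
      products-below {u} {s} {t} u-upper sRt _
                     (_ , (d₁ , d₂ , d₁∈D₁ , d₂∈D₂ , p≡) , refl)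
        with below-L-F sRt d₁∈D₁ | below-L-F sRt d₂∈D₂
      ... | l₁ , l₁∈L , d₁≤l₁ | l₂ , l₂∈L , d₂≤l₂ = subst (_≤ u s) (sym (p≡ t))
        (≤-trans (⊙-mono d₁≤l₁ d₂≤l₂) (u-upper (l₁ ⊙T l₂) (⊙∈products l₁∈L l₂∈L) s))

      ⊡-below : ∀ {u s t} → U (products (L (F D₁)) (L (F D₂))) u → R s t →
        ∀ e → (D₁ ⊡ D₂) e → e t ≤ u s
      ⊡-below {u} {s} {t} u-upper sRt e e∈⊡
        with U-values-lift (products D₁ D₂) t (u s) (products-below u-upper sRt)
      ... | v , v-upper , vt≤us = ≤-trans (proj₁ e∈⊡ v v-upper t) vt≤us

theorem7p6 : (𝐀 : ResiduatedPoset) →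
    SubsetOps.MLUBComplete (ResiduatedPoset._≤_ 𝐀) →
    (T : Set) (R : T → T → Set) → Serial R →
    let open Tense 𝐀 T R in
    (C₁ C₂ D₁ D₂ B₁ B₂ : Sub AT) →
    NonEmpty C₁ → NonEmpty C₂ → NonEmpty D₁ → NonEmpty D₂ →
    NonEmpty B₁ → NonEmpty B₂ →
    -- (DT1)
    ((G (U C₁) ⊡ G (U C₂)) ≤ˢ Min (U (G (U (C₁ ⊡ C₂))))
      × G (B₁ ⇒ B₂) ≤ˢ (G (U B₁) ⇒ G (U B₂)))
    -- (DT2)
    × L (P (D₁ ⊡ D₂)) ≤ˢ U (L (P D₁) ⊡ L (P D₂))
    -- (DT3)
    × ((H (U C₁) ⊡ H (U C₂)) ≤ˢ Min (U (H (U (C₁ ⊡ C₂))))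
      × H (B₁ ⇒ B₂) ≤ˢ (H (U B₁) ⇒ H (U B₂)))
    -- (DT4)
    × L (F (D₁ ⊡ D₂)) ≤ˢ U (L (F D₁) ⊡ L (F D₂))
theorem7p6 𝐀 mlub T R _ C₁ C₂ D₁ D₂ B₁ B₂ _ _ _ _ _ _ =
  (Future.G∘U-⊡ C₁ C₂ , Future.G-⇒ B₁ B₂) , Past.L∘F-⊡ D₁ D₂ ,
  (Past.G∘U-⊡ C₁ C₂ , Past.G-⇒ B₁ B₂) , Future.L∘F-⊡ D₁ D₂
  where
    module Future = TenseProperties 𝐀 mlub T R
    module Past = TenseProperties 𝐀 mlub T (flip R)
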